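{- Let $(\mathscr{L},W)$ be a logical structure with $W$ a $q$-consequence operator, and let $\mathsf{S}=(\mathbf{B},R^q,\models,\mathcal{P}(\mathscr{L}))$ be the normal $S$-semantics for $\mathscr{L}$ with $\mathbf{B}=\{\chi_{W(\Gamma)\cup\Gamma}:\Gamma\subseteq\mathscr{L}\}\cup\{\chi_{W(\Gamma)}:\Gamma\subseteq\mathscr{L}\}$ and $R^q=\{(\chi_{W(\Gamma)\cup\Gamma},\chi_{W(\Gamma)}):\Gamma\subseteq\mathscr{L}\}$. Then $W=W^{\mathsf{S}}_I$.
   Context: A logical structure is a pair $(\mathscr{L},W)$ with $W:\mathcal{P}(\mathscr{L})\to\mathcal{P}(\mathscr{L})$; $W$ is a $q$-consequence operator if $\Gamma\subseteq\Sigma$ implies $W(\Gamma)\subseteq W(\Sigma)$ and $W(W(\Gamma)\cup\Gamma)=W(\Gamma)$ for all $\Gamma$. For $\Gamma\subseteq\mathscr{L}$, $\chi_\Gamma$ is its characteristic function. An $S$-semantics for $\mathscr{L}$ is a tuple $(\mathbf{B},R,\models,\mathcal{P}(\mathscr{L}))$ with $\mathbf{B}\subseteq\{0,1\}^{\mathscr{L}}$, $R\subseteq\mathbf{B}\times\mathbf{B}$, $\models\subseteq\mathbf{B}\times\mathcal{P}(\mathscr{L})$; it is normal if $v\models\Gamma$ iff $v(\Gamma)\subseteq\{1\}$. $W^{\mathsf{S}}_I$ is defined by: $\alpha\in W^{\mathsf{S}}_I(\Gamma)$ iff for all $(v,w)\in R$, $v\models\Gamma$ implies $w\models\{\alpha\}$.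 -}

module Defs where

import Level
open import Level using (0ℓ; Lift)
open import Data.Product using (Σ; _×_)
open import Data.Sum using (_⊎_)
open import Relation.Unary using (Pred; _⊆_; _∪_; _≐_; _∈_; ｛_｝)

Subset : Set → Set₁
Subset L = Pred L 0ℓ

record IsQConsequence {L : Set} (W : Subset L → Subset L) : Set₁ where
  field
    monotone   : ∀ {Γ Σ : Subset L} → Γ ⊆ Σ → W Γ ⊆ W Σ
    q-idempot  : ∀ (Γ : Subset L) → W (W Γ ∪ Γ) ≐ W Γ

-- Bivaluations: elements of {0,1}^L.  A valuation v is represented by
-- the set of formulas it sends to 1 (v(x) = 1 iff x ∈ v).
Valuation : Set → Set₁
Valuation L = Pred L 0ℓ

IsChar : {L : Set} → Valuation L → Subset L → Set
IsChar v Γ = v ≐ Γ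

record SSemantics (L : Set) : Set₂ where
  field
    B   : Valuation L → Set₁
    R   : Valuation L → Valuation L → Set₁
    R⊆B : ∀ {v w} → R v w → B v × B w
    _⊨_ : Valuation L → Subset L → Set₁

IsNormal : {L : Set} → SSemantics L → Set₁
IsNormal {L} S = ∀ (v : Valuation L) (Γ : Subset L) →
  ((v ⊨ Γ → Γ ⊆ v) × (Γ ⊆ v → v ⊨ Γ))
  where open SSemantics S

WSI : {L : Set} → SSemantics L → Subset L → Pred L (Level.suc 0ℓ)
WSI {L} S Γ α = ∀ (v w : Valuation L) → R v w → v ⊨ Γ → w ⊨ ｛ α ｝
  where open SSemantics S

Sq : {L : Set} → (Subset L → Subset L) → SSemantics L
Sq {L} W = record
  { B   = λ v → Σ (Subset L) (λ Γ → IsChar v (W Γ ∪ Γ) ⊎ IsChar v (W Γ))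
  ; R   = λ v w → Σ (Subset L) (λ Γ → IsChar v (W Γ ∪ Γ) × IsChar w (W Γ))
  ; R⊆B = λ { (Γ , cv , cw) → (Γ , inj₁ cv) , (Γ , inj₂ cw) }
  ; _⊨_ = λ v Γ → Lift (Level.suc 0ℓ) (Γ ⊆ v)
  }
  where
    open import Data.Product using (_,_)
    open import Data.Sum using (inj₁; inj₂)

module Submission where

open import Defs
open import Relation.Unary using (_⊆_; _≐_; _∪_)
open import Data.Product using (_,_; proj₁; proj₂)
open import Data.Sum using (inj₂)
open import Function using (id; _∘_)
open import Level using (lift; lower)
open import Relation.Binary.PropositionalEquality using (refl)

-- Completeness is witnessed by the pair (χ_{WΓ∪Γ}, χ_{WΓ}) generated by Γ itself.
-- Soundness: if χ_{WΔ∪Δ} satisfies Γ then Γ ⊆ WΔ ∪ Δ, so by monotonicity and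
-- q-idempotence WΓ ⊆ W(WΔ ∪ Δ) = WΔ, i.e. χ_{WΔ} satisfies every α ∈ WΓ.

module _ {L : Set} {W : Subset L → Subset L} (isQ : IsQConsequence W) where
  open IsQConsequence isQ

  W-mono-into-closure : ∀ {Γ Δ : Subset L} → Γ ⊆ W Δ ∪ Δ → W Γ ⊆ W Δ
  W-mono-into-closure Γ⊆ = proj₁ (q-idempot _) ∘ monotone Γ⊆

  W⊆WSI : ∀ (Γ : Subset L) → W Γ ⊆ WSI (Sq W) Γ
  W⊆WSI Γ α∈WΓ v w (Δ , v≐ , w≐) (lift Γ⊆v) =
    lift λ { refl → proj₂ w≐ (W-mono-into-closure (proj₁ v≐ ∘ Γ⊆v) α∈WΓ) }

WSI⊆W : ∀ {L : Set} (W : Subset L → Subset L) (Γ : Subset L) → WSI (Sq W) Γ ⊆ W Γ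
WSI⊆W W Γ α∈WSI =
  lower (α∈WSI (W Γ ∪ Γ) (W Γ) (Γ , (id , id) , (id , id)) (lift inj₂)) refl

mainTheorem19 : {L : Set} (W : Subset L → Subset L) → IsQConsequence W →
    ∀ (Γ : Subset L) → W Γ ≐ WSI (Sq W) Γ
mainTheorem19 W isQ Γ = W⊆WSI isQ Γ , WSI⊆W W Γ
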